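{- Let $k,n\geq 1$ and let $\Gamma$ be a subgroup of the wreath product $\mathbb{Z}/k\mathbb{Z}\wr S_n$, acting on $nk$ points, and suppose $\Gamma$ has $r$ orbits on these points. Then the proportion $\mathcal{P}(\Gamma)$ of derangements in $\Gamma$ satisfies \[\mathcal{P}(\Gamma)\geq\frac{k-r}{k}.\] Moreover, this inequality is sharp: for fixed $r\le n$ there are subgroups $\Gamma$ of $\mathbb{Z}/k\mathbb{Z}\wr S_n$ with $r$ orbits for which $\mathcal{P}(\Gamma)=\frac{k-r}{k}+O\!\left(\frac{1}{k^2}\right)$ as $k\to\infty$.
   Context: The wreath product $\mathbb{Z}/k\mathbb{Z}\wr S_n$ consists of pairs $((c_1,\dots,c_n),\pi)$ with $c_i\in\mathbb{Z}/k\mathbb{Z}$ and $\pi\in S_n$; it acts on a set of $nk$ points partitioned into $n$ blocks of size $k$, each block arranged as a $k$-cycle, with $\pi$ permuting the blocks and the $c_i$ rotating the blocks cyclically. A derangement is an element fixing no point, and $\mathcal{P}(\Gamma)=|\{\text{derangements in }\Gamma\}|/|\Gamma|$. -}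

module Defs where

open import Data.Nat as ℕ using (ℕ; NonZero; _+_; _∸_)
open import Data.Nat.DivMod using (_mod_)
open import Data.Fin using (Fin; toℕ)
open import Data.Fin.Properties using (all?) renaming (_≟_ to _≟ᶠ_)
open import Data.Fin.Permutation using (Permutation; _⟨$⟩ʳ_; _⟨$⟩ˡ_; _∘ₚ_; flip) renaming (id to idₚ)
open import Data.Product using (Σ; ∃; _×_; _,_)
open import Data.Product.Properties using (≡-dec)
open import Data.List using (List; []; _∷_; length; filter)
open import Data.List.Relation.Unary.All using (All)
open import Data.List.Relation.Unary.Any using (Any)
open import Data.List.Relation.Unary.AllPairs using (AllPairs)
open import Data.Integer using (+_)
open import Data.Rational using (ℚ; _/_; 0ℚ)
open import Relation.Binary.PropositionalEquality using (_≡_; _≢_)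
open import Relation.Nullary using (¬_; Dec; ¬?)

-- Throughout, k ≥ 1 is encoded by the instance NonZero k, and ℤ/kℤ is Fin k
-- with addition modulo k.

module _ {k : ℕ} .{{_ : NonZero k}} where

  _⊕_ : Fin k → Fin k → Fin k
  a ⊕ b = (toℕ a + toℕ b) mod k

  ⊖_ : Fin k → Fin k
  ⊖ a = (k ∸ toℕ a) mod k

  zeroₖ : Fin k
  zeroₖ = 0 mod k

module _ {n k : ℕ} where

  -- an element ((c₁,…,cₙ), π) of the wreath product ℤ/kℤ ≀ Sₙ
  Elem : Set
  Elem = (Fin n → Fin k) × Permutation n n

  -- the nk points: block i, position j in the k-cycle of block i
  Point : Set
  Point = Fin n × Fin k

  _≈_ : Elem → Elem → Set
  (c , π) ≈ (d , σ) = (∀ i → c i ≡ d i) × (∀ i → π ⟨$⟩ʳ i ≡ σ ⟨$⟩ʳ i)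

  _∈Γ_ : Elem → List Elem → Set
  g ∈Γ Γ = Any (g ≈_) Γ

  module _ .{{_ : NonZero k}} where

    act : Elem → Point → Point
    act (c , π) (i , j) = (π ⟨$⟩ʳ i , j ⊕ c i)

    -- group operations (g · h acts as "first h, then g")
    _·_ : Elem → Elem → Elem
    (c , π) · (d , σ) = (λ i → d i ⊕ c (σ ⟨$⟩ʳ i)) , (σ ∘ₚ π)

    e : Elem
    e = (λ _ → zeroₖ) , idₚ

    inv : Elem → Elem
    inv (c , π) = (λ i → ⊖ c (π ⟨$⟩ˡ i)) , flip π

    IsSubgroup : List Elem → Set
    IsSubgroup Γ =
      AllPairs (λ g h → ¬ (g ≈ h)) Γ
      × e ∈Γ Γ
      × All (λ g → All (λ h → (g · h) ∈Γ Γ) Γ) Γ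
      × All (λ g → inv g ∈Γ Γ) Γ

    IsDerangement : Elem → Set
    IsDerangement g = ∀ i j → act g (i , j) ≢ (i , j)

    isDerangement? : (g : Elem) → Dec (IsDerangement g)
    isDerangement? g = all? (λ i → all? (λ j →
      ¬? (≡-dec _≟ᶠ_ _≟ᶠ_ (act g (i , j)) (i , j))))

    HasOrbits : List Elem → ℕ → Set
    HasOrbits Γ r = Σ (Fin r → Point) λ rep →
      (∀ a b → Any (λ g → act g (rep a) ≡ rep b) Γ → a ≡ b)
      × (∀ p → ∃ λ a → Any (λ g → act g (rep a) ≡ p) Γ)

    #der : List Elem → ℕ
    #der Γ = length (filter isDerangement? Γ)

    -- proportion of derangements 𝒫(Γ) = #derangements / |Γ|
    -- (a subgroup is nonempty; the empty list is given the value 0)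
    𝒫 : List Elem → ℚ
    𝒫 [] = 0ℚ
    𝒫 Γ@(_ ∷ xs) = + (#der Γ) / ℕ.suc (length xs)

module Submission where

open import Defs
open import Data.Nat using (ℕ; NonZero; _≤_; _*_)
open import Data.Nat.Properties using (m*n≢0)
open import Data.Integer using (+_) renaming (_-_ to _-ℤ_)
open import Data.Rational using (ℚ; _/_; _-_; ∣_∣) renaming (_≤_ to _≤ℚ_)
open import Data.Product using (Σ; _×_)
open import Data.List using (List)

open import Data.Empty using (⊥-elim)
open import Data.Fin as Fin using (Fin; zero; suc; toℕ; _↑ˡ_; _↑ʳ_; splitAt; join)
open import Data.Fin.Permutation using (Permutation; _⟨$⟩ʳ_; _⟨$⟩ˡ_; inverseʳ; permutation)
open import Data.Fin.Properties
  using ( toℕ-fromℕ<; toℕ-injective; toℕ<n; toℕ≤n; ¬∀⟶∃¬; all?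
        ; splitAt-↑ˡ; splitAt-↑ʳ; splitAt⁻¹-↑ˡ; splitAt⁻¹-↑ʳ; ↑ˡ-injective; ↑ʳ-injective)
import Data.Fin.Properties as Finₚ
open import Data.Integer as ℤ using (+≤+)
import Data.Integer.Properties as ℤₚ
import Data.Integer.Tactic.RingSolver as ℤ-Solver
open import Data.List using ([]; _∷_; _++_; length; filter; map; tabulate; allFin; cartesianProductWith)
open import Data.List.Membership.Propositional using (_∈_; find)
open import Data.List.Membership.Propositional.Properties using (∈-filter⁻; ∈-cartesianProductWith⁻; ∈-allFin)
import Data.List.Membership.Setoid as SetoidMembership
import Data.List.Membership.Setoid.Properties as SetoidMembershipₚ
open import Data.List.Properties using (length-map)
open import Data.List.Relation.Unary.All as All using (All; []; _∷_)
import Data.List.Relation.Unary.All.Properties as All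
open import Data.List.Relation.Unary.AllPairs using ([]; _∷_)
open import Data.List.Relation.Unary.Any using (Any; here; there)
open import Data.List.Relation.Unary.Unique.Propositional.Properties using (allFin⁺)
import Data.List.Relation.Unary.Unique.Setoid as SetoidUnique
import Data.List.Relation.Unary.Unique.Setoid.Properties as SetoidUniqueₚ
open import Data.Nat as ℕ using (zero; suc; _+_; _^_; _∸_; _%_; z≤n; s≤s)
open import Data.Nat.DivMod using (_mod_; %-distribˡ-+; m%n%n≡m%n; m<n⇒m%n≡m; n%n≡0)
open import Data.Nat.Properties
import Data.Nat.Tactic.RingSolver as ℕ-Solver
open import Algebra.Properties.CommutativeSemigroup +-commutativeSemigroup using (interchange)
open import Data.Product using (∃; _,_; proj₁; proj₂)
open import Data.Product.Properties using (≡-dec)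
import Data.Rational as ℚ
import Data.Rational.Properties as ℚₚ
open import Data.Rational.Unnormalised as ℚᵘ using (mkℚᵘ; *≤*)
import Data.Rational.Unnormalised.Properties as ℚᵘₚ
open import Data.Sum as Sum using (inj₁; inj₂)
import Data.Vec.Functional as Vector
open import Function using (_∘_; id)
open import Level using (0ℓ)
open import Relation.Binary using (Setoid; DecidableEquality; _Respects_)
open import Relation.Binary.PropositionalEquality
import Relation.Binary.PropositionalEquality.Properties as ≡
open import Relation.Nullary using (¬_; ¬?; Dec; yes; no; contradiction)
open import Relation.Nullary.Decidable using (decidable-stable; _×-dec_)
open import Relation.Unary using (Pred; Decidable)

-- A non-derangement g = (c, π) fixes some point (i, j), which forces π i = i and c i = 0, so g fixes all k
-- points of block i. Hence k (|Γ| − #der Γ) is at most the total number of fixed points, which by Burnside's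
-- lemma is r |Γ|; this is the lower bound 𝒫(Γ) ≥ (k − r)/k.
-- For sharpness write n = m + r − 1 and let Γ consist of all (c, π) with π a cyclic shift of the first m blocks.
-- Its orbits are the union of the first m blocks and each of the other r − 1 blocks. The coset π = id contains
-- (k − 1)ⁿ derangements and each of the other m − 1 cosets kᵐ (k − 1)ʳ⁻¹, so the Bernoulli-type estimate
-- (k − 1)ʲ ≤ kʲ − j kʲ⁻¹ + j² kʲ⁻² puts 𝒫(Γ) within (n² + (m − 1)(r − 1)²)/k² of (k − r)/k.

𝟙 : {P : Set} → Dec P → ℕ
𝟙 (yes _) = 1
𝟙 (no _) = 0

𝟙-yes : {P : Set} → P → (d : Dec P) → 𝟙 d ≡ 1
𝟙-yes p (yes _) = refl
𝟙-yes p (no ¬p) = contradiction p ¬p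

𝟙-no : {P : Set} → ¬ P → (d : Dec P) → 𝟙 d ≡ 0
𝟙-no ¬p (yes p) = contradiction p ¬p
𝟙-no ¬p (no _) = refl

𝟙-cong : {P Q : Set} → (P → Q) → (Q → P) → (d : Dec P) (d′ : Dec Q) → 𝟙 d ≡ 𝟙 d′
𝟙-cong f g (yes p) d′ = sym (𝟙-yes (f p) d′)
𝟙-cong f g (no ¬p) d′ = sym (𝟙-no (¬p ∘ g) d′)

∑ : (n : ℕ) → (Fin n → ℕ) → ℕ
∑ zero f = 0
∑ (suc n) f = f zero + ∑ n (f ∘ suc)

∑-cong : ∀ n {f g : Fin n → ℕ} → (∀ i → f i ≡ g i) → ∑ n f ≡ ∑ n g
∑-cong zero eq = refl
∑-cong (suc n) eq = cong₂ _+_ (eq zero) (∑-cong n (eq ∘ suc))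

∑-mono-≤ : ∀ n {f g : Fin n → ℕ} → (∀ i → f i ≤ g i) → ∑ n f ≤ ∑ n g
∑-mono-≤ zero le = z≤n
∑-mono-≤ (suc n) le = +-mono-≤ (le zero) (∑-mono-≤ n (le ∘ suc))

∑-distrib-+ : ∀ n (f g : Fin n → ℕ) → ∑ n (λ i → f i + g i) ≡ ∑ n f + ∑ n g
∑-distrib-+ zero f g = refl
∑-distrib-+ (suc n) f g = trans (cong (_+_ (f zero + g zero)) (∑-distrib-+ n (f ∘ suc) (g ∘ suc)))
  (interchange (f zero) (g zero) (∑ n (f ∘ suc)) (∑ n (g ∘ suc)))

∑-const : ∀ n c → ∑ n (λ _ → c) ≡ n * c
∑-const zero c = refl
∑-const (suc n) c = cong (_+_ c) (∑-const n c)

∑-zero : ∀ n → ∑ n (λ _ → 0) ≡ 0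
∑-zero n = trans (∑-const n 0) (*-zeroʳ n)

∑-term-≤ : ∀ n (f : Fin n → ℕ) a → f a ≤ ∑ n f
∑-term-≤ (suc n) f zero = m≤m+n _ _
∑-term-≤ (suc n) f (suc a) = ≤-trans (∑-term-≤ n (f ∘ suc) a) (m≤n+m _ _)

∑-supported : ∀ n (f : Fin n → ℕ) a → (∀ i → i ≢ a → f i ≡ 0) → ∑ n f ≡ f a
∑-supported (suc n) f zero off = trans (cong (_+_ (f zero)) (trans (∑-cong n (λ i → off (suc i) λ ())) (∑-zero n))) (+-identityʳ _)
∑-supported (suc n) f (suc a) off = trans (cong (_+ ∑ n (f ∘ suc)) (off zero λ ()))
  (∑-supported n (f ∘ suc) a (λ i i≢a → off (suc i) (i≢a ∘ Finₚ.suc-injective)))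

∑-comm : ∀ n m (f : Fin n → Fin m → ℕ) → ∑ n (λ i → ∑ m (f i)) ≡ ∑ m (λ j → ∑ n (λ i → f i j))
∑-comm n zero f = ∑-zero n
∑-comm n (suc m) f = trans (∑-distrib-+ n (λ i → f i zero) (λ i → ∑ m (f i ∘ suc)))
  (cong (_+_ (∑ n (λ i → f i zero))) (∑-comm n m (λ i → f i ∘ suc)))

module _ {A : Set} where

  ∑ˡ : List A → (A → ℕ) → ℕ
  ∑ˡ [] f = 0
  ∑ˡ (x ∷ xs) f = f x + ∑ˡ xs f

  ∑ˡ-cong : ∀ xs {f g : A → ℕ} → (∀ x → f x ≡ g x) → ∑ˡ xs f ≡ ∑ˡ xs g
  ∑ˡ-cong [] eq = refl
  ∑ˡ-cong (x ∷ xs) eq = cong₂ _+_ (eq x) (∑ˡ-cong xs eq)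

  ∑ˡ-mono-≤ : ∀ xs {f g : A → ℕ} → (∀ x → f x ≤ g x) → ∑ˡ xs f ≤ ∑ˡ xs g
  ∑ˡ-mono-≤ [] le = z≤n
  ∑ˡ-mono-≤ (x ∷ xs) le = +-mono-≤ (le x) (∑ˡ-mono-≤ xs le)

  ∑ˡ-distrib-+ : ∀ xs (f g : A → ℕ) → ∑ˡ xs (λ x → f x + g x) ≡ ∑ˡ xs f + ∑ˡ xs g
  ∑ˡ-distrib-+ [] f g = refl
  ∑ˡ-distrib-+ (x ∷ xs) f g = trans (cong (_+_ (f x + g x)) (∑ˡ-distrib-+ xs f g))
    (interchange (f x) (g x) (∑ˡ xs f) (∑ˡ xs g))

  ∑ˡ-*ˡ : ∀ xs c (f : A → ℕ) → ∑ˡ xs (λ x → c * f x) ≡ c * ∑ˡ xs f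
  ∑ˡ-*ˡ [] c f = sym (*-zeroʳ c)
  ∑ˡ-*ˡ (x ∷ xs) c f = trans (cong (_+_ (c * f x)) (∑ˡ-*ˡ xs c f)) (sym (*-distribˡ-+ c (f x) (∑ˡ xs f)))

  ∑ˡ-*ʳ : ∀ xs c (f : A → ℕ) → ∑ˡ xs (λ x → f x * c) ≡ ∑ˡ xs f * c
  ∑ˡ-*ʳ xs c f = trans (∑ˡ-cong xs (λ x → *-comm (f x) c)) (trans (∑ˡ-*ˡ xs c f) (*-comm c _))

  ∑ˡ-const : ∀ xs c → ∑ˡ xs (λ _ → c) ≡ length xs * c
  ∑ˡ-const [] c = refl
  ∑ˡ-const (x ∷ xs) c = cong (_+_ c) (∑ˡ-const xs c)

  ∑ˡ-one : ∀ xs → ∑ˡ xs (λ _ → 1) ≡ length xs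
  ∑ˡ-one xs = trans (∑ˡ-const xs 1) (*-identityʳ _)

  ∑ˡ-𝟙 : {P : Pred A _} (P? : Decidable P) → ∀ xs → ∑ˡ xs (𝟙 ∘ P?) ≡ length (filter P? xs)
  ∑ˡ-𝟙 P? [] = refl
  ∑ˡ-𝟙 P? (x ∷ xs) with P? x
  ... | yes _ = cong suc (∑ˡ-𝟙 P? xs)
  ... | no _ = ∑ˡ-𝟙 P? xs

  ∑ˡ-++ : ∀ xs ys (f : A → ℕ) → ∑ˡ (xs ++ ys) f ≡ ∑ˡ xs f + ∑ˡ ys f
  ∑ˡ-++ [] ys f = refl
  ∑ˡ-++ (x ∷ xs) ys f = trans (cong (_+_ (f x)) (∑ˡ-++ xs ys f)) (sym (+-assoc (f x) _ _))

  ∑-∑ˡ-comm : ∀ n xs (f : Fin n → A → ℕ) → ∑ n (λ i → ∑ˡ xs (f i)) ≡ ∑ˡ xs (λ x → ∑ n (λ i → f i x))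
  ∑-∑ˡ-comm n [] f = ∑-zero n
  ∑-∑ˡ-comm n (x ∷ xs) f = trans (∑-distrib-+ n (λ i → f i x) (λ i → ∑ˡ xs (f i)))
    (cong (_+_ (∑ n (λ i → f i x))) (∑-∑ˡ-comm n xs f))

module _ {A B : Set} where

  ∑ˡ-map : ∀ (g : A → B) xs (f : B → ℕ) → ∑ˡ (map g xs) f ≡ ∑ˡ xs (f ∘ g)
  ∑ˡ-map g [] f = refl
  ∑ˡ-map g (x ∷ xs) f = cong (_+_ (f (g x))) (∑ˡ-map g xs f)

module _ {A B C : Set} where

  ∑ˡ-cartesianProductWith : ∀ (g : A → B → C) xs ys (f : C → ℕ) →
    ∑ˡ (cartesianProductWith g xs ys) f ≡ ∑ˡ xs (λ x → ∑ˡ ys (λ y → f (g x y)))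
  ∑ˡ-cartesianProductWith g [] ys f = refl
  ∑ˡ-cartesianProductWith g (x ∷ xs) ys f = begin
    ∑ˡ (map (g x) ys ++ cartesianProductWith g xs ys) f
      ≡⟨ ∑ˡ-++ (map (g x) ys) _ f ⟩
    ∑ˡ (map (g x) ys) f + ∑ˡ (cartesianProductWith g xs ys) f
      ≡⟨ cong₂ _+_ (∑ˡ-map (g x) ys f) (∑ˡ-cartesianProductWith g xs ys f) ⟩
    ∑ˡ ys (f ∘ g x) + ∑ˡ xs (λ x → ∑ˡ ys (λ y → f (g x y)))
      ∎
    where open ≡-Reasoning

∑ˡ-tabulate : {A : Set} → ∀ n (g : Fin n → A) (f : A → ℕ) → ∑ˡ (tabulate g) f ≡ ∑ n (f ∘ g)
∑ˡ-tabulate zero g f = refl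
∑ˡ-tabulate (suc n) g f = cong (_+_ (f (g zero))) (∑ˡ-tabulate n (g ∘ suc) f)

∑ˡ-allFin : ∀ n (f : Fin n → ℕ) → ∑ˡ (allFin n) f ≡ ∑ n f
∑ˡ-allFin n = ∑ˡ-tabulate n id

∏ : (n : ℕ) → (Fin n → ℕ) → ℕ
∏ zero f = 1
∏ (suc n) f = f zero * ∏ n (f ∘ suc)

∏-cong : ∀ n {f g : Fin n → ℕ} → (∀ i → f i ≡ g i) → ∏ n f ≡ ∏ n g
∏-cong zero eq = refl
∏-cong (suc n) eq = cong₂ _*_ (eq zero) (∏-cong n (eq ∘ suc))

∏-const : ∀ n c → ∏ n (λ _ → c) ≡ c ^ n
∏-const zero c = refl
∏-const (suc n) c = cong (c *_) (∏-const n c)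

∏-split : ∀ m r (f : Fin (m + r) → ℕ) → ∏ (m + r) f ≡ ∏ m (f ∘ (_↑ˡ r)) * ∏ r (f ∘ (m ↑ʳ_))
∏-split zero r f = sym (+-identityʳ _)
∏-split (suc m) r f = trans (cong (f zero *_) (∏-split m r (f ∘ suc))) (sym (*-assoc (f zero) _ _))

𝟙-∀ : ∀ n {Q : Fin n → Set} (Q? : ∀ i → Dec (Q i)) (d : Dec (∀ i → Q i)) → 𝟙 d ≡ ∏ n (𝟙 ∘ Q?)
𝟙-∀ zero Q? d = 𝟙-yes (λ ()) d
𝟙-∀ (suc n) Q? d with Q? zero
... | yes q = trans (𝟙-cong (λ ∀Q → ∀Q ∘ suc) (λ ∀Q′ → λ { zero → q ; (suc i) → ∀Q′ i }) d (all? (Q? ∘ suc)))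
                    (trans (𝟙-∀ n (Q? ∘ suc) (all? (Q? ∘ suc))) (sym (+-identityʳ _)))
... | no ¬q = 𝟙-no (λ ∀Q → ¬q (∀Q zero)) d

module _ {k : ℕ} .{{_ : NonZero k}} where

  toℕ-⊕ : (a b : Fin k) → toℕ (a ⊕ b) ≡ (toℕ a + toℕ b) % k
  toℕ-⊕ a b = toℕ-fromℕ< _

  toℕ-zeroₖ : toℕ (zeroₖ {k}) ≡ 0
  toℕ-zeroₖ = trans (toℕ-fromℕ< _) (m<n⇒m%n≡m (ℕ.>-nonZero⁻¹ k))

  toℕ-⊖ : (a : Fin k) → toℕ (⊖ a) ≡ (k ∸ toℕ a) % k
  toℕ-⊖ a = toℕ-fromℕ< _

  toℕ%k : (a : Fin k) → toℕ a % k ≡ toℕ a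
  toℕ%k a = m<n⇒m%n≡m (toℕ<n a)

  [m+n%k]%k : ∀ m n → (m + n % k) % k ≡ (m + n) % k
  [m+n%k]%k m n = begin
    (m + n % k) % k           ≡⟨ %-distribˡ-+ m (n % k) k ⟩
    (m % k + n % k % k) % k   ≡⟨ cong (λ x → (m % k + x) % k) (m%n%n≡m%n n k) ⟩
    (m % k + n % k) % k       ≡⟨ %-distribˡ-+ m n k ⟨
    (m + n) % k               ∎
    where open ≡-Reasoning

  ⊕-comm : (a b : Fin k) → a ⊕ b ≡ b ⊕ a
  ⊕-comm a b = cong (_mod k) (+-comm (toℕ a) (toℕ b))

  ⊕-assoc : (a b c : Fin k) → (a ⊕ b) ⊕ c ≡ a ⊕ (b ⊕ c)
  ⊕-assoc a b c = toℕ-injective (begin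
    toℕ ((a ⊕ b) ⊕ c)                 ≡⟨ toℕ-⊕ (a ⊕ b) c ⟩
    (toℕ (a ⊕ b) + toℕ c) % k         ≡⟨ cong (λ x → (x + toℕ c) % k) (toℕ-⊕ a b) ⟩
    ((toℕ a + toℕ b) % k + toℕ c) % k ≡⟨ cong (_% k) (+-comm _ (toℕ c)) ⟩
    (toℕ c + (toℕ a + toℕ b) % k) % k ≡⟨ [m+n%k]%k (toℕ c) _ ⟩
    (toℕ c + (toℕ a + toℕ b)) % k     ≡⟨ cong (_% k) (trans (+-comm (toℕ c) _) (+-assoc (toℕ a) _ _)) ⟩
    (toℕ a + (toℕ b + toℕ c)) % k     ≡⟨ [m+n%k]%k (toℕ a) _ ⟨
    (toℕ a + (toℕ b + toℕ c) % k) % k ≡⟨ cong (λ x → (toℕ a + x) % k) (toℕ-⊕ b c) ⟨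
    (toℕ a + toℕ (b ⊕ c)) % k         ≡⟨ toℕ-⊕ a (b ⊕ c) ⟨
    toℕ (a ⊕ (b ⊕ c))                 ∎)
    where open ≡-Reasoning

  ⊕-identityʳ : (a : Fin k) → a ⊕ zeroₖ ≡ a
  ⊕-identityʳ a = toℕ-injective (begin
    toℕ (a ⊕ zeroₖ)         ≡⟨ toℕ-⊕ a zeroₖ ⟩
    (toℕ a + toℕ zeroₖ) % k ≡⟨ cong (λ x → (toℕ a + x) % k) toℕ-zeroₖ ⟩
    (toℕ a + 0) % k         ≡⟨ cong (_% k) (+-identityʳ (toℕ a)) ⟩
    toℕ a % k               ≡⟨ toℕ%k a ⟩
    toℕ a                   ∎)
    where open ≡-Reasoning

  ⊕-identityˡ : (a : Fin k) → zeroₖ ⊕ a ≡ a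
  ⊕-identityˡ a = trans (⊕-comm zeroₖ a) (⊕-identityʳ a)

  ⊕-inverseʳ : (a : Fin k) → a ⊕ (⊖ a) ≡ zeroₖ
  ⊕-inverseʳ a = toℕ-injective (begin
    toℕ (a ⊕ (⊖ a))                 ≡⟨ toℕ-⊕ a (⊖ a) ⟩
    (toℕ a + toℕ (⊖ a)) % k         ≡⟨ cong (λ x → (toℕ a + x) % k) (toℕ-⊖ a) ⟩
    (toℕ a + (k ∸ toℕ a) % k) % k   ≡⟨ [m+n%k]%k (toℕ a) _ ⟩
    (toℕ a + (k ∸ toℕ a)) % k       ≡⟨ cong (_% k) (m+[n∸m]≡n (toℕ≤n a)) ⟩
    k % k                           ≡⟨ n%n≡0 k ⟩
    0                               ≡⟨ toℕ-zeroₖ ⟨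
    toℕ (zeroₖ {k})                 ∎)
    where open ≡-Reasoning

  ⊕-inverseˡ : (a : Fin k) → (⊖ a) ⊕ a ≡ zeroₖ
  ⊕-inverseˡ a = trans (⊕-comm (⊖ a) a) (⊕-inverseʳ a)

  ⊕-cancelˡ : (a b c : Fin k) → a ⊕ b ≡ a ⊕ c → b ≡ c
  ⊕-cancelˡ a b c eq = begin
    b                 ≡⟨ ⊕-identityˡ b ⟨
    zeroₖ ⊕ b         ≡⟨ cong (_⊕ b) (⊕-inverseˡ a) ⟨
    ((⊖ a) ⊕ a) ⊕ b   ≡⟨ ⊕-assoc (⊖ a) a b ⟩
    (⊖ a) ⊕ (a ⊕ b)   ≡⟨ cong ((⊖ a) ⊕_) eq ⟩
    (⊖ a) ⊕ (a ⊕ c)   ≡⟨ ⊕-assoc (⊖ a) a c ⟨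
    ((⊖ a) ⊕ a) ⊕ c   ≡⟨ cong (_⊕ c) (⊕-inverseˡ a) ⟩
    zeroₖ ⊕ c         ≡⟨ ⊕-identityˡ c ⟩
    c                 ∎
    where open ≡-Reasoning

  ⊕-fixes⇒zero : (a b : Fin k) → a ⊕ b ≡ a → toℕ b ≡ 0
  ⊕-fixes⇒zero a b eq = trans (cong toℕ (⊕-cancelˡ a b zeroₖ (trans eq (sym (⊕-identityʳ a))))) toℕ-zeroₖ

  zero⇒⊕-fixes : (a b : Fin k) → toℕ b ≡ 0 → a ⊕ b ≡ a
  zero⇒⊕-fixes a b b≡0 = trans (cong (a ⊕_) (toℕ-injective (trans b≡0 (sym toℕ-zeroₖ)))) (⊕-identityʳ a)

module _ {c ℓ} (S : Setoid c ℓ) where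

  open Setoid S using () renaming (Carrier to A; _≈_ to _∼_; sym to ∼-sym; trans to ∼-trans)
  open SetoidMembership S using () renaming (_∈_ to _∈ₛ_)
  open SetoidUnique S using (Unique)

  private
    remove : ∀ {x} ys → x ∈ₛ ys →
      Σ (List A) λ ys′ → suc (length ys′) ≡ length ys × (∀ {z} → z ∈ₛ ys → ¬ z ∼ x → z ∈ₛ ys′)
    remove (y ∷ ys) (here x≈y) = ys , refl , λ where
      (here z≈y) z≉x → contradiction (∼-trans z≈y (∼-sym x≈y)) z≉x
      (there z∈ys) _ → z∈ys
    remove (y ∷ ys) (there x∈ys) =
      let ys′ , len , keep = remove ys x∈ys
      in y ∷ ys′ , cong suc len , λ where
           (here z≈y) _ → here z≈y
           (there z∈ys) z≉x → there (keep z∈ys z≉x)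

  length-mono-⊆ : ∀ {xs ys} → Unique xs → All (_∈ₛ ys) xs → length xs ≤ length ys
  length-mono-⊆ [] [] = z≤n
  length-mono-⊆ {x ∷ xs} {ys} (x≉xs ∷ xs!) (x∈ys ∷ xs⊆ys) =
    let ys′ , len , keep = remove ys x∈ys
    in subst (suc (length xs) ≤_) len
         (s≤s (length-mono-⊆ xs! (All.zipWith (λ (x≉z , z∈ys) → keep z∈ys (x≉z ∘ ∼-sym)) (x≉xs , xs⊆ys))))

≈-setoid : ∀ {n k} → Setoid 0ℓ 0ℓ
≈-setoid {n} {k} = record
  { Carrier = Elem {n} {k}
  ; _≈_ = _≈_ {n} {k}
  ; isEquivalence = record
    { refl = (λ _ → refl) , (λ _ → refl)
    ; sym = λ (c≗d , π≗σ) → (sym ∘ c≗d) , (sym ∘ π≗σ)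
    ; trans = λ (c≗d , π≗σ) (d≗e , σ≗τ) → (λ i → trans (c≗d i) (d≗e i)) , (λ i → trans (π≗σ i) (σ≗τ i))
    }
  }

module _ {n k : ℕ} .{{_ : NonZero k}} where

  act-cong : ∀ {g h : Elem {n} {k}} → g ≈ h → (p : Point {n} {k}) → act g p ≡ act h p
  act-cong (c≗d , π≗σ) (i , j) = cong₂ _,_ (π≗σ i) (cong (j ⊕_) (c≗d i))

  act-resp : ∀ q p → (λ g → act g q ≡ p) Respects (_≈_ {n} {k})
  act-resp q p {g} {g′} g≈g′ gq≡p = trans (sym (act-cong {g = g} {g′} g≈g′ q)) gq≡p

  act-· : (g h : Elem {n} {k}) (p : Point {n} {k}) → act (g · h) p ≡ act g (act h p)
  act-· (c , π) (d , σ) (i , j) = cong (π ⟨$⟩ʳ (σ ⟨$⟩ʳ i) ,_) (sym (⊕-assoc j (d i) (c (σ ⟨$⟩ʳ i))))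

  ·-cancelʳ : (g g′ h : Elem {n} {k}) → (g · h) ≈ (g′ · h) → g ≈ g′
  ·-cancelʳ (c , π) (c′ , π′) (d , σ) (cd≗c′d , σπ≗σπ′) =
    (λ i → subst (λ j → c j ≡ c′ j) (inverseʳ σ) (⊕-cancelˡ (d (σ ⟨$⟩ˡ i)) _ _ (cd≗c′d (σ ⟨$⟩ˡ i)))) ,
    (λ i → subst (λ j → π ⟨$⟩ʳ j ≡ π′ ⟨$⟩ʳ j) (inverseʳ σ) (σπ≗σπ′ (σ ⟨$⟩ˡ i)))

module _ {n k : ℕ} .{{_ : NonZero k}} where

  _≟ᴾ_ : DecidableEquality (Point {n} {k})
  _≟ᴾ_ = ≡-dec Fin._≟_ Fin._≟_

  δ : Point {n} {k} → Point {n} {k} → ℕ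
  δ p q = 𝟙 (p ≟ᴾ q)

  ∑ᴾ : (Point {n} {k} → ℕ) → ℕ
  ∑ᴾ f = ∑ n λ i → ∑ k λ j → f (i , j)

  ∑ᴾ-mono-≤ : {f g : Point {n} {k} → ℕ} → (∀ p → f p ≤ g p) → ∑ᴾ f ≤ ∑ᴾ g
  ∑ᴾ-mono-≤ f≤g = ∑-mono-≤ n λ i → ∑-mono-≤ k λ j → f≤g (i , j)

  ∑ᴾ-δ : (p : Point {n} {k}) → ∑ᴾ (δ p) ≡ 1
  ∑ᴾ-δ (a , b) = trans (∑-supported n _ a off-block) (trans (∑-supported k _ b off-point) (𝟙-yes refl ((a , b) ≟ᴾ (a , b))))
    where
    off-block : ∀ i → i ≢ a → ∑ k (λ j → δ (a , b) (i , j)) ≡ 0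
    off-block i i≢a = trans (∑-cong k λ j → 𝟙-no (i≢a ∘ sym ∘ cong proj₁) ((a , b) ≟ᴾ (i , j))) (∑-zero k)
    off-point : ∀ j → j ≢ b → δ (a , b) (a , j) ≡ 0
    off-point j j≢b = 𝟙-no (j≢b ∘ sym ∘ cong proj₂) ((a , b) ≟ᴾ (a , j))

  ∑ᴾ-∑ˡ-comm : {A : Set} (xs : List A) (f : Point {n} {k} → A → ℕ) →
    ∑ᴾ (λ p → ∑ˡ xs (f p)) ≡ ∑ˡ xs (λ x → ∑ᴾ (λ p → f p x))
  ∑ᴾ-∑ˡ-comm xs f = trans (∑-cong n λ i → ∑-∑ˡ-comm k xs λ j → f (i , j))
    (∑-∑ˡ-comm n xs λ i x → ∑ k λ j → f (i , j) x)

  ∑ᴾ-∑-comm : ∀ r (f : Point {n} {k} → Fin r → ℕ) → ∑ᴾ (λ p → ∑ r (f p)) ≡ ∑ r (λ a → ∑ᴾ (λ p → f p a))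
  ∑ᴾ-∑-comm r f = trans (∑-cong n λ i → ∑-comm k r λ j → f (i , j))
    (∑-comm n r λ i a → ∑ k λ j → f (i , j) a)

  FixesBlock : Elem {n} {k} → Fin n → Set
  FixesBlock (c , π) i = π ⟨$⟩ʳ i ≡ i × toℕ (c i) ≡ 0

  fixed⇒FixesBlock : ∀ g {i j} → act g (i , j) ≡ (i , j) → FixesBlock g i
  fixed⇒FixesBlock (c , π) {i} {j} eq = cong proj₁ eq , ⊕-fixes⇒zero j (c i) (cong proj₂ eq)

  FixesBlock⇒fixed : ∀ g {i} → FixesBlock g i → ∀ j → act g (i , j) ≡ (i , j)
  FixesBlock⇒fixed (c , π) {i} (πi≡i , ci≡0) j = cong₂ _,_ πi≡i (zero⇒⊕-fixes j (c i) ci≡0)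

  derangement⇒¬FixesBlock : ∀ g → IsDerangement g → ∀ i → ¬ FixesBlock g i
  derangement⇒¬FixesBlock g der i fixes = der i zeroₖ (FixesBlock⇒fixed g fixes zeroₖ)

  ¬FixesBlock⇒derangement : ∀ g → (∀ i → ¬ FixesBlock g i) → IsDerangement g
  ¬FixesBlock⇒derangement g moves i j = moves i ∘ fixed⇒FixesBlock g

  fixesBlock? : ∀ g i → Dec (FixesBlock g i)
  fixesBlock? (c , π) i = (π ⟨$⟩ʳ i Fin.≟ i) ×-dec (toℕ (c i) ℕ.≟ 0)

  𝟙-derangement : ∀ g → 𝟙 (isDerangement? g) ≡ ∏ n (λ i → 𝟙 (¬? (fixesBlock? g i)))
  𝟙-derangement g = trans
    (𝟙-cong (derangement⇒¬FixesBlock g) (¬FixesBlock⇒derangement g) (isDerangement? g) (all? λ i → ¬? (fixesBlock? g i)))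
    (𝟙-∀ n (λ i → ¬? (fixesBlock? g i)) _)

  fixed-point : ∀ g → ¬ IsDerangement g → ∃ λ p → act g p ≡ p
  fixed-point g ¬der =
    let i , ¬der-i = ¬∀⟶∃¬ n _ (λ i → all? λ j → ¬? (act g (i , j) ≟ᴾ (i , j))) ¬der
        j , ¬moved = ¬∀⟶∃¬ k _ (λ j → ¬? (act g (i , j) ≟ᴾ (i , j))) ¬der-i
    in (i , j) , decidable-stable (act g (i , j) ≟ᴾ (i , j)) ¬moved

  #fix : Elem {n} {k} → ℕ
  #fix g = ∑ᴾ λ p → δ (act g p) p

  k≤#fix : ∀ g → ¬ IsDerangement g → k ≤ #fix g
  k≤#fix g ¬der with fixed-point g ¬der
  ... | (i , j) , gp≡p = begin
    k                                     ≡⟨ *-identityʳ k ⟨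
    k * 1                                 ≡⟨ ∑-const k 1 ⟨
    ∑ k (λ _ → 1)                         ≡⟨ ∑-cong k (λ j′ → 𝟙-yes (fixed j′) _) ⟨
    ∑ k (λ j′ → δ (act g (i , j′)) (i , j′)) ≤⟨ ∑-term-≤ n (λ i → ∑ k λ j → δ (act g (i , j)) (i , j)) i ⟩
    #fix g                                ∎
    where
    open ≤-Reasoning
    fixed : ∀ j′ → act g (i , j′) ≡ (i , j′)
    fixed = FixesBlock⇒fixed g (fixed⇒FixesBlock g gp≡p)

  k≤k*𝟙der+#fix : ∀ g → k ≤ k * 𝟙 (isDerangement? g) + #fix g
  k≤k*𝟙der+#fix g with isDerangement? g
  ... | yes _ = ≤-trans (≤-reflexive (sym (*-identityʳ k))) (m≤m+n _ _)
  ... | no ¬der = ≤-trans (k≤#fix g ¬der) (m≤n+m _ _)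

module _ {n k : ℕ} .{{_ : NonZero k}} (Γ : List (Elem {n} {k})) where

  private
    𝔾 : Setoid 0ℓ 0ℓ
    𝔾 = ≈-setoid {n} {k}

  #maps : Point {n} {k} → Point {n} {k} → ℕ
  #maps q p = ∑ˡ Γ λ g → δ (act g q) p

  #stab : Point {n} {k} → ℕ
  #stab p = #maps p p

  ∑ᴾ-#maps : ∀ q → ∑ᴾ (#maps q) ≡ length Γ
  ∑ᴾ-#maps q = begin
    ∑ᴾ (#maps q)                     ≡⟨ ∑ᴾ-∑ˡ-comm Γ (λ p g → δ (act g q) p) ⟩
    ∑ˡ Γ (λ g → ∑ᴾ (δ (act g q)))    ≡⟨ ∑ˡ-cong Γ (λ g → ∑ᴾ-δ (act g q)) ⟩
    ∑ˡ Γ (λ _ → 1)                   ≡⟨ ∑ˡ-one Γ ⟩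
    length Γ                         ∎
    where open ≡-Reasoning

  -- g ↦ g · h injects the stabiliser of p into the elements mapping q to p.
  #stab≤#maps : IsSubgroup Γ → ∀ {h q p} → h ∈ Γ → act h q ≡ p → #stab p ≤ #maps q p
  #stab≤#maps (Γ! , _ , closed , _) {h} {q} {p} h∈Γ hq≡p =
    subst₂ _≤_ (trans (length-map (_· h) stab) (sym (∑ˡ-𝟙 fixes? Γ))) (sym (∑ˡ-𝟙 maps? Γ))
      (length-mono-⊆ 𝔾
        (SetoidUniqueₚ.map⁺ 𝔾 𝔾 (λ {g} {g′} → ·-cancelʳ g g′ h) (SetoidUniqueₚ.filter⁺ 𝔾 fixes? Γ!))
        (All.map⁺ (All.tabulate λ g∈stab → ·h∈maps (∈-filter⁻ fixes? g∈stab))))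
    where
    fixes? : Decidable (λ g → act g p ≡ p)
    fixes? g = act g p ≟ᴾ p
    maps? : Decidable (λ g → act g q ≡ p)
    maps? g = act g q ≟ᴾ p
    stab : List (Elem {n} {k})
    stab = filter fixes? Γ
    ·h∈maps : ∀ {g} → g ∈ Γ × act g p ≡ p → SetoidMembership._∈_ 𝔾 (g · h) (filter maps? Γ)
    ·h∈maps {g} (g∈Γ , gp≡p) = SetoidMembershipₚ.∈-filter⁺ 𝔾 maps? (λ {g} {g′} → act-resp q p {g} {g′})
      {v = g · h} (All.lookup (All.lookup closed g∈Γ) h∈Γ)
      (trans (act-· g h q) (trans (cong (act g) hq≡p) gp≡p))

  ∑#fix≤r*|Γ| : IsSubgroup Γ → ∀ r → HasOrbits Γ r → ∑ˡ Γ #fix ≤ r * length Γ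
  ∑#fix≤r*|Γ| Γ-subgroup r (rep , _ , covers) = begin
    ∑ˡ Γ #fix                                 ≡⟨ ∑ᴾ-∑ˡ-comm Γ (λ p g → δ (act g p) p) ⟨
    ∑ᴾ #stab                                  ≤⟨ ∑ᴾ-mono-≤ #stab≤∑#maps ⟩
    ∑ᴾ (λ p → ∑ r (λ a → #maps (rep a) p))    ≡⟨ ∑ᴾ-∑-comm r (λ p a → #maps (rep a) p) ⟩
    ∑ r (λ a → ∑ᴾ (#maps (rep a)))            ≡⟨ ∑-cong r (λ a → ∑ᴾ-#maps (rep a)) ⟩
    ∑ r (λ _ → length Γ)                      ≡⟨ ∑-const r (length Γ) ⟩
    r * length Γ                              ∎
    where
    open ≤-Reasoning
    #stab≤∑#maps : ∀ p → #stab p ≤ ∑ r (λ a → #maps (rep a) p)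
    #stab≤∑#maps p with covers p
    ... | a , reaches with find reaches
    ... | h , h∈Γ , h-rep≡p = ≤-trans (#stab≤#maps Γ-subgroup h∈Γ h-rep≡p) (∑-term-≤ r (λ a → #maps (rep a) p) a)

  k*|Γ|≤k*#der+r*|Γ| : IsSubgroup Γ → ∀ r → HasOrbits Γ r → k * length Γ ≤ k * #der Γ + r * length Γ
  k*|Γ|≤k*#der+r*|Γ| Γ-subgroup r orbits = begin
    k * length Γ                                      ≡⟨ *-comm k (length Γ) ⟩
    length Γ * k                                      ≡⟨ ∑ˡ-const Γ k ⟨
    ∑ˡ Γ (λ _ → k)                                    ≤⟨ ∑ˡ-mono-≤ Γ k≤k*𝟙der+#fix ⟩
    ∑ˡ Γ (λ g → k * 𝟙 (isDerangement? g) + #fix g)    ≡⟨ ∑ˡ-distrib-+ Γ _ #fix ⟩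
    ∑ˡ Γ (λ g → k * 𝟙 (isDerangement? g)) + ∑ˡ Γ #fix ≡⟨ cong (_+ ∑ˡ Γ #fix) (∑ˡ-*ˡ Γ k _) ⟩
    k * ∑ˡ Γ (𝟙 ∘ isDerangement?) + ∑ˡ Γ #fix         ≡⟨ cong (λ x → k * x + ∑ˡ Γ #fix) (∑ˡ-𝟙 isDerangement? Γ) ⟩
    k * #der Γ + ∑ˡ Γ #fix                            ≤⟨ +-monoʳ-≤ (k * #der Γ) (∑#fix≤r*|Γ| Γ-subgroup r orbits) ⟩
    k * #der Γ + r * length Γ                         ∎
    where open ≤-Reasoning

toℚᵘ-/suc : ∀ p a → ℚ.toℚᵘ (p / suc a) ℚᵘ.≃ mkℚᵘ p a
toℚᵘ-/suc p a = ℚₚ.toℚᵘ-fromℚᵘ (mkℚᵘ p a)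

/suc-≤ : ∀ p q a b → p ℤ.* + suc b ℤ.≤ q ℤ.* + suc a → p / suc a ℚ.≤ q / suc b
/suc-≤ p q a b p*b≤q*a = ℚₚ.toℚᵘ-cancel-≤
  (ℚᵘₚ.≤-respˡ-≃ (ℚᵘₚ.≃-sym (toℚᵘ-/suc p a))
    (ℚᵘₚ.≤-respʳ-≃ (ℚᵘₚ.≃-sym (toℚᵘ-/suc q b)) (*≤* p*b≤q*a)))

[k-r]/k≤D/N : ∀ t L D r → suc t * suc L ≤ suc t * D + r * suc L →
  (+ suc t ℤ.- + r) / suc t ℚ.≤ + D / suc L
[k-r]/k≤D/N t L D r kN≤kD+rN = /suc-≤ (+ k ℤ.- + r) (+ D) t L (begin
  (+ k ℤ.- + r) ℤ.* + N                 ≡⟨ *-distribʳ-- (+ k) (+ r) (+ N) ⟩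
  + k ℤ.* + N ℤ.- + r ℤ.* + N           ≡⟨ cong₂ ℤ._-_ (ℤₚ.pos-* k N) (ℤₚ.pos-* r N) ⟨
  + (k * N) ℤ.- + (r * N)               ≤⟨ ℤₚ.+-monoˡ-≤ (ℤ.- + (r * N)) (+≤+ kN≤kD+rN) ⟩
  + (k * D + r * N) ℤ.- + (r * N)       ≡⟨ cong (ℤ._- + (r * N)) (ℤₚ.pos-+ (k * D) (r * N)) ⟩
  + (k * D) ℤ.+ + (r * N) ℤ.- + (r * N) ≡⟨ +-cancelʳ-- (+ (k * D)) (+ (r * N)) ⟩
  + (k * D)                             ≡⟨ cong +_ (*-comm k D) ⟩
  + (D * k)                             ≡⟨ ℤₚ.pos-* D k ⟩
  + D ℤ.* + k                           ∎)
  where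
  open ℤₚ.≤-Reasoning
  k N : ℕ
  k = suc t
  N = suc L
  *-distribʳ-- : ∀ x y z → (x ℤ.- y) ℤ.* z ≡ x ℤ.* z ℤ.- y ℤ.* z
  *-distribʳ-- = ℤ-Solver.solve-∀
  +-cancelʳ-- : ∀ x y → x ℤ.+ y ℤ.- y ≡ x
  +-cancelʳ-- = ℤ-Solver.solve-∀

[k-r]/k≤𝒫 : ∀ n k .{{_ : NonZero k}} (Γ : List (Elem {n} {k})) → IsSubgroup Γ →
  ∀ r → HasOrbits Γ r → (+ k ℤ.- + r) / k ℚ.≤ 𝒫 Γ
[k-r]/k≤𝒫 n zero = ⊥-elim (ℕ.≢-nonZero⁻¹ zero refl)
[k-r]/k≤𝒫 n (suc t) [] (_ , () , _)
[k-r]/k≤𝒫 n (suc t) Γ@(_ ∷ _) Γ-subgroup r orbits =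
  [k-r]/k≤D/N t _ (#der Γ) r (k*|Γ|≤k*#der+r*|Γ| Γ Γ-subgroup r orbits)

#nonzero : ∀ k → ∑ k (λ x → 𝟙 (¬? (toℕ x ℕ.≟ 0))) ≡ k ∸ 1
#nonzero zero = refl
#nonzero (suc k) = trans (∑-const k 1) (*-identityʳ k)

module _ {B : Set} (b : Dec B) where

  #¬[B×x≡0]≡k∸1 : ∀ k → B → ∑ k (λ x → 𝟙 (¬? (b ×-dec (toℕ x ℕ.≟ 0)))) ≡ k ∸ 1
  #¬[B×x≡0]≡k∸1 k β = trans
    (∑-cong k λ x → 𝟙-cong (λ ¬β×0 x≡0 → ¬β×0 (β , x≡0)) (λ x≢0 (_ , x≡0) → x≢0 x≡0) _ _)
    (#nonzero k)

  #¬[B×x≡0]≡k : ∀ k → ¬ B → ∑ k (λ x → 𝟙 (¬? (b ×-dec (toℕ x ℕ.≟ 0)))) ≡ k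
  #¬[B×x≡0]≡k k ¬β = trans (∑-cong k λ x → 𝟙-yes (¬β ∘ proj₁) _) (trans (∑-const k 1) (*-identityʳ k))

module _ {k : ℕ} where

  allFunctions : ∀ n → List (Fin n → Fin k)
  allFunctions zero = (λ ()) ∷ []
  allFunctions (suc n) = cartesianProductWith Vector._∷_ (allFin k) (allFunctions n)

  ∑-allFunctions-∏ : ∀ n (w : Fin n → Fin k → ℕ) →
    ∑ˡ (allFunctions n) (λ c → ∏ n (λ i → w i (c i))) ≡ ∏ n (λ i → ∑ k (w i))
  ∑-allFunctions-∏ zero w = refl
  ∑-allFunctions-∏ (suc n) w = begin
    ∑ˡ (allFunctions (suc n)) (λ c → ∏ (suc n) (λ i → w i (c i)))
      ≡⟨ ∑ˡ-cartesianProductWith Vector._∷_ (allFin k) (allFunctions n) _ ⟩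
    ∑ˡ (allFin k) (λ x → ∑ˡ (allFunctions n) (λ c → w zero x * ∏ n (λ i → w (suc i) (c i))))
      ≡⟨ ∑ˡ-cong (allFin k) (λ x → ∑ˡ-*ˡ (allFunctions n) (w zero x) _) ⟩
    ∑ˡ (allFin k) (λ x → w zero x * ∑ˡ (allFunctions n) (λ c → ∏ n (λ i → w (suc i) (c i))))
      ≡⟨ ∑ˡ-cong (allFin k) (λ x → cong (w zero x *_) (∑-allFunctions-∏ n (w ∘ suc))) ⟩
    ∑ˡ (allFin k) (λ x → w zero x * ∏ n (λ i → ∑ k (w (suc i))))
      ≡⟨ ∑ˡ-*ʳ (allFin k) _ (w zero) ⟩
    ∑ˡ (allFin k) (w zero) * ∏ n (λ i → ∑ k (w (suc i)))
      ≡⟨ cong (_* ∏ n (λ i → ∑ k (w (suc i)))) (∑ˡ-allFin k (w zero)) ⟩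
    ∏ (suc n) (λ i → ∑ k (w i))
      ∎
    where open ≡-Reasoning

  length-allFunctions : ∀ n → length (allFunctions n) ≡ k ^ n
  length-allFunctions n = begin
    length (allFunctions n)                        ≡⟨ ∑ˡ-one (allFunctions n) ⟨
    ∑ˡ (allFunctions n) (λ _ → 1)                  ≡⟨ ∑ˡ-cong (allFunctions n) (λ _ → trans (∏-const n 1) (^-zeroˡ n)) ⟨
    ∑ˡ (allFunctions n) (λ _ → ∏ n (λ _ → 1))      ≡⟨ ∑-allFunctions-∏ n (λ _ _ → 1) ⟩
    ∏ n (λ _ → ∑ k (λ _ → 1))                      ≡⟨ ∏-cong n (λ _ → trans (∑-const k 1) (*-identityʳ k)) ⟩
    ∏ n (λ _ → k)                                  ≡⟨ ∏-const n k ⟩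
    k ^ n                                          ∎
    where open ≡-Reasoning

  private
    Functions : ℕ → Setoid 0ℓ 0ℓ
    Functions n = Fin n →-setoid Fin k

  ∈-allFunctions : ∀ n (c : Fin n → Fin k) → SetoidMembership._∈_ (Functions n) c (allFunctions n)
  ∈-allFunctions zero c = here λ ()
  ∈-allFunctions (suc n) c = SetoidMembershipₚ.∈-resp-≈ (Functions (suc n)) head∷tail≗c
    (SetoidMembershipₚ.∈-cartesianProductWith⁺ (≡.setoid (Fin k)) (Functions n) (Functions (suc n))
      ∷-cong (∈-allFin (c zero)) (∈-allFunctions n (c ∘ suc)))
    where
    head∷tail≗c : ∀ i → (c zero Vector.∷ (c ∘ suc)) i ≡ c i
    head∷tail≗c zero = refl
    head∷tail≗c (suc i) = refl
    ∷-cong : ∀ {x y} {d e : Fin n → Fin k} → x ≡ y → (∀ i → d i ≡ e i) → ∀ i → (x Vector.∷ d) i ≡ (y Vector.∷ e) i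
    ∷-cong x≡y d≗e zero = x≡y
    ∷-cong x≡y d≗e (suc i) = d≗e i

  allFunctions-unique : ∀ n → SetoidUnique.Unique (Functions n) (allFunctions n)
  allFunctions-unique zero = [] ∷ []
  allFunctions-unique (suc n) = SetoidUniqueₚ.cartesianProductWith⁺ (≡.setoid (Fin k)) (Functions n) (Functions (suc n))
    Vector._∷_ (λ x∷d≗y∷e → x∷d≗y∷e zero , x∷d≗y∷e ∘ suc) (allFin⁺ k) (allFunctions-unique n)

↑ˡ≢↑ʳ : ∀ {m} r {x : Fin m} {y} → x ↑ˡ r ≢ m ↑ʳ y
↑ˡ≢↑ʳ {m} r {x} {y} eq with trans (sym (splitAt-↑ˡ m x r)) (trans (cong (splitAt m) eq) (splitAt-↑ʳ m r y))
... | ()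

module Rotation (m′ r′ : ℕ) where

  m n : ℕ
  m = suc m′
  n = m + r′

  rotate : Fin m → Fin n → Fin n
  rotate s i = join m r′ (Sum.map₁ (_⊕ s) (splitAt m i))

  rotate-↑ˡ : ∀ s x → rotate s (x ↑ˡ r′) ≡ (x ⊕ s) ↑ˡ r′
  rotate-↑ˡ s x = cong (join m r′ ∘ Sum.map₁ (_⊕ s)) (splitAt-↑ˡ m x r′)

  rotate-↑ʳ : ∀ s y → rotate s (m ↑ʳ y) ≡ m ↑ʳ y
  rotate-↑ʳ s y = cong (join m r′ ∘ Sum.map₁ (_⊕ s)) (splitAt-↑ʳ m r′ y)

  rotate-∘ : ∀ s t i → rotate s (rotate t i) ≡ rotate (t ⊕ s) i
  rotate-∘ s t i with splitAt m i
  ... | inj₁ x = trans (rotate-↑ˡ s (x ⊕ t)) (cong (_↑ˡ r′) (⊕-assoc x t s))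
  ... | inj₂ y = rotate-↑ʳ s y

  rotate-zero : ∀ i → rotate zero i ≡ i
  rotate-zero i with splitAt m i in eq
  ... | inj₁ x = trans (cong (_↑ˡ r′) (⊕-identityʳ x)) (splitAt⁻¹-↑ˡ eq)
  ... | inj₂ y = splitAt⁻¹-↑ʳ eq

  rotate-inverse : ∀ s t → t ⊕ s ≡ zero → ∀ i → rotate s (rotate t i) ≡ i
  rotate-inverse s t t⊕s≡0 i = trans (rotate-∘ s t i) (trans (cong (λ u → rotate u i) t⊕s≡0) (rotate-zero i))

  rotation : Fin m → Permutation n n
  rotation s = permutation (rotate s) (rotate (⊖ s))
    (rotate-inverse s (⊖ s) (⊕-inverseˡ s)) (rotate-inverse (⊖ s) s (⊕-inverseʳ s))

  rotate-moves : ∀ s → toℕ s ≢ 0 → ∀ x → rotate s (x ↑ˡ r′) ≢ x ↑ˡ r′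
  rotate-moves s s≢0 x eq = s≢0 (⊕-fixes⇒zero x s (↑ˡ-injective r′ _ _ (trans (sym (rotate-↑ˡ s x)) eq)))

  -- Block 0 represents the orbit of the first m blocks; each remaining block is its own orbit.
  orbitBlock : Fin (suc r′) → Fin n
  orbitBlock zero = zero ↑ˡ r′
  orbitBlock (suc y) = m ↑ʳ y

  rotate-orbitBlock-injective : ∀ s a b → rotate s (orbitBlock a) ≡ orbitBlock b → a ≡ b
  rotate-orbitBlock-injective s zero zero eq = refl
  rotate-orbitBlock-injective s zero (suc y) eq = ⊥-elim (↑ˡ≢↑ʳ r′ (trans (sym (rotate-↑ˡ s zero)) eq))
  rotate-orbitBlock-injective s (suc y) zero eq = ⊥-elim (↑ˡ≢↑ʳ r′ (trans (sym eq) (rotate-↑ʳ s y)))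
  rotate-orbitBlock-injective s (suc y) (suc y′) eq = cong suc (↑ʳ-injective m y y′ (trans (sym (rotate-↑ʳ s y)) eq))

module RotationSubgroup (m′ r′ k : ℕ) .{{_ : NonZero k}} where

  open Rotation m′ r′

  shifts : List (Fin n → Fin k)
  shifts = allFunctions n

  -- The paper's Γ = (ℤ/kℤ)ⁿ ⋊ C_m: any rotation of each block, combined with a cyclic shift of the first m blocks.
  Γ : List (Elem {n} {k})
  Γ = cartesianProductWith (λ s c → c , rotation s) (allFin m) shifts

  private
    𝔾 : Setoid 0ℓ 0ℓ
    𝔾 = ≈-setoid {n} {k}

  ∈Γ : ∀ g s → (∀ i → proj₂ g ⟨$⟩ʳ i ≡ rotate s i) → g ∈Γ Γ
  ∈Γ (c , π) s π≗rotate = SetoidMembershipₚ.∈-resp-≈ 𝔾 {x = c , rotation s} {y = c , π} ((λ _ → refl) , sym ∘ π≗rotate)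
    (SetoidMembershipₚ.∈-cartesianProductWith⁺ (≡.setoid (Fin m)) (Fin n →-setoid Fin k) 𝔾
      (λ { refl c≗c′ → c≗c′ , λ _ → refl }) (∈-allFin s) (∈-allFunctions n c))

  All-Γ : {P : Elem {n} {k} → Set} → (∀ s c → P (c , rotation s)) → All P Γ
  All-Γ {P} P-rotation = All.tabulate λ g∈Γ →
    let s , c , _ , _ , g≡ = ∈-cartesianProductWith⁻ (λ s c → c , rotation s) (allFin m) shifts g∈Γ
    in subst P (sym g≡) (P-rotation s c)

  Γ-unique : SetoidUnique.Unique 𝔾 Γ
  Γ-unique = SetoidUniqueₚ.cartesianProductWith⁺ (≡.setoid (Fin m)) (Fin n →-setoid Fin k) 𝔾 _
    (λ {s} {s′} (c≗c′ , ρ≗ρ′) → ⊕-cancelˡ zero s s′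
      (↑ˡ-injective r′ _ _ (trans (sym (rotate-↑ˡ s zero)) (trans (ρ≗ρ′ (zero ↑ˡ r′)) (rotate-↑ˡ s′ zero)))) , c≗c′)
    (allFin⁺ m) (allFunctions-unique {k} n)

  Γ-subgroup : IsSubgroup Γ
  Γ-subgroup = Γ-unique
    , ∈Γ e zero (sym ∘ rotate-zero)
    , All-Γ (λ s c → All-Γ (λ t d → ∈Γ ((c , rotation s) · (d , rotation t)) (t ⊕ s) (rotate-∘ s t)))
    , All-Γ (λ s c → ∈Γ (inv (c , rotation s)) (⊖ s) (λ _ → refl))

  orbitRep : Fin (suc r′) → Point {n} {k}
  orbitRep a = orbitBlock a , zeroₖ

  private
    reaches : ∀ s v a p → act ((λ _ → v) , rotation s) (orbitRep a) ≡ p → Any (λ g → act g (orbitRep a) ≡ p) Γ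
    reaches s v a p eq = SetoidMembership.lose 𝔾 (λ {g} {g′} → act-resp (orbitRep a) p {g} {g′})
      {x = (λ _ → v) , rotation s} (∈Γ ((λ _ → v) , rotation s) s (λ _ → refl)) eq

  Γ-orbits : HasOrbits Γ (suc r′)
  Γ-orbits = orbitRep , distinct , covers
    where
    distinct : ∀ a b → Any (λ g → act g (orbitRep a) ≡ orbitRep b) Γ → a ≡ b
    distinct a b reaches-b =
      let g , g∈Γ , ga≡b = find reaches-b
      in All.lookup (All-Γ {P = λ g → act g (orbitRep a) ≡ orbitRep b → a ≡ b}
                      (λ s c eq → rotate-orbitBlock-injective s a b (cong proj₁ eq)))
                    g∈Γ ga≡b
    covers : ∀ p → ∃ λ a → Any (λ g → act g (orbitRep a) ≡ p) Γ
    covers (i , v) with splitAt m i in eq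
    ... | inj₁ x = zero , reaches x v zero (i , v)
      (cong₂ _,_ (trans (rotate-↑ˡ x zero) (trans (cong (_↑ˡ r′) (⊕-identityˡ x)) (splitAt⁻¹-↑ˡ eq))) (⊕-identityˡ v))
    ... | inj₂ y = suc y , reaches zero v (suc y) (i , v)
      (cong₂ _,_ (trans (rotate-↑ʳ zero y) (splitAt⁻¹-↑ʳ eq)) (⊕-identityˡ v))

  length-Γ : length Γ ≡ m * k ^ n
  length-Γ = begin
    length Γ                                   ≡⟨ ∑ˡ-one Γ ⟨
    ∑ˡ Γ (λ _ → 1)                             ≡⟨ ∑ˡ-cartesianProductWith (λ s c → c , rotation s) (allFin m) shifts (λ _ → 1) ⟩
    ∑ˡ (allFin m) (λ _ → ∑ˡ shifts (λ _ → 1))  ≡⟨ ∑ˡ-cong (allFin m) (λ _ → ∑ˡ-one shifts) ⟩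
    ∑ˡ (allFin m) (λ _ → length shifts)        ≡⟨ ∑ˡ-cong (allFin m) (λ _ → length-allFunctions {k} n) ⟩
    ∑ˡ (allFin m) (λ _ → k ^ n)                ≡⟨ ∑ˡ-allFin m _ ⟩
    ∑ m (λ _ → k ^ n)                          ≡⟨ ∑-const m (k ^ n) ⟩
    m * k ^ n                                  ∎
    where open ≡-Reasoning

  private
    weight : Fin m → Fin n → Fin k → ℕ
    weight s i x = 𝟙 (¬? ((rotate s i Fin.≟ i) ×-dec (toℕ x ℕ.≟ 0)))

    #der-coset : Fin m → ℕ
    #der-coset s = ∏ n (λ i → ∑ k (weight s i))

    #der-coset-zero : #der-coset zero ≡ (k ∸ 1) ^ m * (k ∸ 1) ^ r′
    #der-coset-zero = trans (∏-split m r′ (λ i → ∑ k (weight zero i))) (cong₂ _*_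
      (trans (∏-cong m λ x → #¬[B×x≡0]≡k∸1 (_ Fin.≟ _) k (rotate-zero (x ↑ˡ r′))) (∏-const m (k ∸ 1)))
      (trans (∏-cong r′ λ y → #¬[B×x≡0]≡k∸1 (_ Fin.≟ _) k (rotate-zero (m ↑ʳ y))) (∏-const r′ (k ∸ 1))))

    #der-coset-suc : ∀ s → #der-coset (suc s) ≡ k ^ m * (k ∸ 1) ^ r′
    #der-coset-suc s = trans (∏-split m r′ (λ i → ∑ k (weight (suc s) i))) (cong₂ _*_
      (trans (∏-cong m λ x → #¬[B×x≡0]≡k (_ Fin.≟ _) k (rotate-moves (suc s) (λ ()) x)) (∏-const m k))
      (trans (∏-cong r′ λ y → #¬[B×x≡0]≡k∸1 (_ Fin.≟ _) k (rotate-↑ʳ (suc s) y)) (∏-const r′ (k ∸ 1))))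

  #der-Γ : #der Γ ≡ (k ∸ 1) ^ m * (k ∸ 1) ^ r′ + m′ * (k ^ m * (k ∸ 1) ^ r′)
  #der-Γ = begin
    #der Γ
      ≡⟨ ∑ˡ-𝟙 isDerangement? Γ ⟨
    ∑ˡ Γ (𝟙 ∘ isDerangement?)
      ≡⟨ ∑ˡ-cartesianProductWith (λ s c → c , rotation s) (allFin m) shifts (𝟙 ∘ isDerangement?) ⟩
    ∑ˡ (allFin m) (λ s → ∑ˡ shifts (λ c → 𝟙 (isDerangement? (c , rotation s))))
      ≡⟨ ∑ˡ-cong (allFin m) (λ s → ∑ˡ-cong shifts (λ c → 𝟙-derangement (c , rotation s))) ⟩
    ∑ˡ (allFin m) (λ s → ∑ˡ shifts (λ c → ∏ n (λ i → weight s i (c i))))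
      ≡⟨ ∑ˡ-cong (allFin m) (λ s → ∑-allFunctions-∏ {k} n (weight s)) ⟩
    ∑ˡ (allFin m) #der-coset
      ≡⟨ ∑ˡ-allFin m #der-coset ⟩
    #der-coset zero + ∑ m′ (#der-coset ∘ suc)
      ≡⟨ cong₂ _+_ #der-coset-zero (trans (∑-cong m′ #der-coset-suc) (∑-const m′ _)) ⟩
    (k ∸ 1) ^ m * (k ∸ 1) ^ r′ + m′ * (k ^ m * (k ∸ 1) ^ r′)
      ∎
    where open ≡-Reasoning

module _ (t : ℕ) where

  private
    k : ℕ
    k = suc t

  -- (k − 1)^j ≤ k^j − j k^(j−1) + j² k^(j−2), multiplied by k² and with no subtraction.
  k²[k-1]^j-bound : ∀ j → k * k * t ^ j + j * (k * k ^ j) ≤ k * (k * k ^ j) + j * j * k ^ j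
  k²[k-1]^j-bound zero = ≤-reflexive (cong (_+ 0) (*-assoc k k 1))
  k²[k-1]^j-bound (suc j) = +-cancelʳ-≤ (t * j * (k * K)) _ _ (begin
    k * k * (t * T) + suc j * (k * (k * K)) + t * j * (k * K)   ≡⟨ expand t T K j ⟩
    t * (k * k * T + j * (k * K)) + suc j * (k * (k * K))       ≤⟨ +-monoˡ-≤ _ (*-monoʳ-≤ t (k²[k-1]^j-bound j)) ⟩
    t * (k * (k * K) + j * j * K) + suc j * (k * (k * K))       ≤⟨ m≤m+n _ ((suc j * k + j * j) * K) ⟩
    t * (k * (k * K) + j * j * K) + suc j * (k * (k * K)) + (suc j * k + j * j) * K
                                                                ≡⟨ collect t K j ⟩
    k * (k * (k * K)) + suc j * suc j * (k * K) + t * j * (k * K) ∎)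
    where
    open ≤-Reasoning
    K T : ℕ
    K = k ^ j
    T = t ^ j
    expand : ∀ t T K j → suc t * suc t * (t * T) + suc j * (suc t * (suc t * K)) + t * j * (suc t * K)
                       ≡ t * (suc t * suc t * T + j * (suc t * K)) + suc j * (suc t * (suc t * K))
    expand = ℕ-Solver.solve-∀
    collect : ∀ t K j → t * (suc t * (suc t * K) + j * j * K) + suc j * (suc t * (suc t * K)) + (suc j * suc t + j * j) * K
                      ≡ suc t * (suc t * (suc t * K)) + suc j * suc j * (suc t * K) + t * j * (suc t * K)
    collect = ℕ-Solver.solve-∀

module _ (t m′ r′ : ℕ) where

  private
    k m n r a b u v : ℕ
    k = suc t
    m = suc m′
    n = m + r′
    r = suc r′
    a = k ^ m
    b = k ^ r′
    u = t ^ m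
    v = t ^ r′

  -- For the rotation subgroup, with D = #der Γ and N = |Γ|, this says D/N ≤ (k − r)/k + C/k².
  rotation-error-bound : k * k * (u * v + m′ * (a * v)) + k * r * (m * k ^ n) ≤ k * k * (m * k ^ n) + (n * n + m′ * (r′ * r′)) * (m * k ^ n)
  rotation-error-bound = begin
    k * k * (u * v + m′ * (a * v)) + k * r * (m * k ^ n)
      ≡⟨ cong (λ x → k * k * (u * v + m′ * (a * v)) + k * r * (m * x)) kⁿ≡ab ⟩
    k * k * (u * v + m′ * (a * v)) + k * r * (m * (a * b))
      ≡⟨ split m′ r′ k a b u v ⟩
    (k * k * (u * v) + n * (k * (a * b))) + m′ * a * (k * k * v + r′ * (k * b))
      ≤⟨ +-mono-≤ (subst₂ (λ x y → k * k * y + n * (k * x) ≤ k * (k * x) + n * n * x) kⁿ≡ab tⁿ≡uv (k²[k-1]^j-bound t n))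
                  (*-monoʳ-≤ (m′ * a) (k²[k-1]^j-bound t r′)) ⟩
    (k * (k * (a * b)) + n * n * (a * b)) + m′ * a * (k * (k * b) + r′ * r′ * b)
      ≡⟨ merge m′ r′ k a b ⟩
    k * k * (m * (a * b)) + (n * n + m′ * (r′ * r′)) * (a * b)
      ≤⟨ +-monoʳ-≤ (k * k * (m * (a * b))) (*-monoʳ-≤ (n * n + m′ * (r′ * r′)) (m≤m+n (a * b) (m′ * (a * b)))) ⟩
    k * k * (m * (a * b)) + (n * n + m′ * (r′ * r′)) * (m * (a * b))
      ≡⟨ cong (λ x → k * k * (m * x) + (n * n + m′ * (r′ * r′)) * (m * x)) kⁿ≡ab ⟨
    k * k * (m * k ^ n) + (n * n + m′ * (r′ * r′)) * (m * k ^ n) ∎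
    where
    open ≤-Reasoning
    kⁿ≡ab : k ^ n ≡ a * b
    kⁿ≡ab = ^-distribˡ-+-* k m r′
    tⁿ≡uv : t ^ n ≡ u * v
    tⁿ≡uv = ^-distribˡ-+-* t m r′
    split : ∀ m′ r′ k a b u v →
      k * k * (u * v + m′ * (a * v)) + k * suc r′ * (suc m′ * (a * b))
        ≡ (k * k * (u * v) + (suc m′ + r′) * (k * (a * b))) + m′ * a * (k * k * v + r′ * (k * b))
    split = ℕ-Solver.solve-∀
    merge : ∀ m′ r′ k a b →
      (k * (k * (a * b)) + (suc m′ + r′) * (suc m′ + r′) * (a * b)) + m′ * a * (k * (k * b) + r′ * r′ * b)
        ≡ k * k * (suc m′ * (a * b)) + ((suc m′ + r′) * (suc m′ + r′) + m′ * (r′ * r′)) * (a * b)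
    merge = ℕ-Solver.solve-∀

excess-bound : ∀ k r w N D C → r + w ≡ k → k * N ≤ k * D + r * N → k * k * D + k * r * N ≤ k * k * N + C * N →
  Σ ℕ λ E → k * D ≡ w * N + E × E * k ≤ C * N
excess-bound k r w N D C r+w≡k kN≤kD+rN kkD+krN≤kkN+CN = E , sym (m+[n∸m]≡n wN≤kD) , Ek≤CN
  where
  open ≤-Reasoning
  kN≡rN+wN : k * N ≡ r * N + w * N
  kN≡rN+wN = trans (cong (_* N) (sym r+w≡k)) (*-distribʳ-+ N r w)
  wN≤kD : w * N ≤ k * D
  wN≤kD = +-cancelˡ-≤ (r * N) _ _ (begin
    r * N + w * N ≡⟨ kN≡rN+wN ⟨
    k * N         ≤⟨ kN≤kD+rN ⟩
    k * D + r * N ≡⟨ +-comm (k * D) (r * N) ⟩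
    r * N + k * D ∎)
  E : ℕ
  E = k * D ∸ w * N
  kkD≤kwN+CN : k * k * D ≤ k * w * N + C * N
  kkD≤kwN+CN = +-cancelʳ-≤ (k * r * N) _ _ (begin
    k * k * D + k * r * N               ≤⟨ kkD+krN≤kkN+CN ⟩
    k * k * N + C * N                   ≡⟨ cong (λ x → x + C * N) (trans (*-assoc k k N) (cong (k *_) kN≡rN+wN)) ⟩
    k * (r * N + w * N) + C * N         ≡⟨ rearrange k (r * N) (w * N) (C * N) ⟩
    k * (w * N) + C * N + k * (r * N)   ≡⟨ cong₂ (λ x y → x + C * N + y) (*-assoc k w N) (*-assoc k r N) ⟨
    k * w * N + C * N + k * r * N       ∎)
    where
    rearrange : ∀ k x y z → k * (x + y) + z ≡ k * y + z + k * x
    rearrange = ℕ-Solver.solve-∀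
  Ek≤CN : E * k ≤ C * N
  Ek≤CN = +-cancelʳ-≤ (k * w * N) _ _ (begin
    E * k + k * w * N     ≡⟨ cong₂ _+_ (*-comm E k) (*-assoc k w N) ⟩
    k * E + k * (w * N)   ≡⟨ trans (sym (*-distribˡ-+ k E (w * N))) (cong (k *_) (trans (+-comm E (w * N)) (m+[n∸m]≡n wN≤kD))) ⟩
    k * (k * D)           ≡⟨ *-assoc k k D ⟨
    k * k * D             ≤⟨ kkD≤kwN+CN ⟩
    k * w * N + C * N     ≡⟨ +-comm (k * w * N) (C * N) ⟩
    C * N + k * w * N     ∎)

-- With k = r + w and k D = w N + E, the difference D/N − (k − r)/k is exactly E/(kN).
∣D/N-[k-r]/k∣≤C/k² : ∀ t L D r w C E → r + w ≡ suc t → suc t * D ≡ w * suc L + E → E * suc t ≤ C * suc L →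
  ℚ.∣ + D / suc L ℚ.- (+ suc t ℤ.- + r) / suc t ∣ ℚ.≤ _/_ (+ C) (suc t * suc t) {{m*n≢0 (suc t) (suc t)}}
∣D/N-[k-r]/k∣≤C/k² t L D r w C E r+w≡k kD≡wN+E Ek≤CN = ℚₚ.toℚᵘ-cancel-≤
  (ℚᵘₚ.≤-respˡ-≃ (ℚᵘₚ.≃-sym toℚᵘ-lhs)
    (ℚᵘₚ.≤-respʳ-≃ (ℚᵘₚ.≃-sym (toℚᵘ-/suc (+ C) (t + t * suc t))) (*≤* cross)))
  where
  k N : ℕ
  k = suc t
  N = suc L
  X : ℤ.ℤ
  X = + k ℤ.- + r
  toℚᵘ-lhs : ℚ.toℚᵘ ℚ.∣ + D / N ℚ.- X / k ∣ ℚᵘ.≃ ℚᵘ.∣ mkℚᵘ (+ D) L ℚᵘ.- mkℚᵘ X t ∣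
  toℚᵘ-lhs = begin
    ℚ.toℚᵘ ℚ.∣ + D / N ℚ.- X / k ∣                      ≈⟨ ℚₚ.toℚᵘ-homo-∣-∣ (+ D / N ℚ.- X / k) ⟩
    ℚᵘ.∣ ℚ.toℚᵘ (+ D / N ℚ.- X / k) ∣                   ≈⟨ ℚᵘₚ.∣-∣-cong (ℚₚ.toℚᵘ-homo-+ (+ D / N) (ℚ.- (X / k))) ⟩
    ℚᵘ.∣ ℚ.toℚᵘ (+ D / N) ℚᵘ.+ ℚ.toℚᵘ (ℚ.- (X / k)) ∣    ≈⟨ ℚᵘₚ.∣-∣-cong (ℚᵘₚ.+-cong (toℚᵘ-/suc (+ D) L)
                                                           (ℚᵘₚ.≃-trans (ℚₚ.toℚᵘ-homo‿- (X / k)) (ℚᵘₚ.-‿cong (toℚᵘ-/suc X t)))) ⟩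
    ℚᵘ.∣ mkℚᵘ (+ D) L ℚᵘ.- mkℚᵘ X t ∣                   ∎
    where open ℚᵘₚ.≃-Reasoning
  numerator≡E : + D ℤ.* + k ℤ.+ ℤ.- X ℤ.* + N ≡ + E
  numerator≡E = begin
    + D ℤ.* + k ℤ.+ ℤ.- (+ k ℤ.- + r) ℤ.* + N         ≡⟨ cong (λ x → + D ℤ.* + k ℤ.+ ℤ.- (x ℤ.- + r) ℤ.* + N) +k≡+r++w ⟩
    + D ℤ.* + k ℤ.+ ℤ.- (+ r ℤ.+ + w ℤ.- + r) ℤ.* + N ≡⟨ shuffle (+ D) (+ k) (+ r) (+ w) (+ N) ⟩
    + k ℤ.* + D ℤ.- + w ℤ.* + N                      ≡⟨ cong₂ ℤ._-_ (ℤₚ.pos-* k D) (ℤₚ.pos-* w N) ⟨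
    + (k * D) ℤ.- + (w * N)                          ≡⟨ cong (λ x → + x ℤ.- + (w * N)) kD≡wN+E ⟩
    + (w * N + E) ℤ.- + (w * N)                      ≡⟨ cong (ℤ._- + (w * N)) (ℤₚ.pos-+ (w * N) E) ⟩
    + (w * N) ℤ.+ + E ℤ.- + (w * N)                  ≡⟨ cancel (+ (w * N)) (+ E) ⟩
    + E                                              ∎
    where
    open ≡-Reasoning
    +k≡+r++w : + k ≡ + r ℤ.+ + w
    +k≡+r++w = trans (cong +_ (sym r+w≡k)) (ℤₚ.pos-+ r w)
    shuffle : ∀ d k r w n → d ℤ.* k ℤ.+ ℤ.- (r ℤ.+ w ℤ.- r) ℤ.* n ≡ k ℤ.* d ℤ.- w ℤ.* n
    shuffle = ℤ-Solver.solve-∀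
    cancel : ∀ x y → x ℤ.+ y ℤ.- x ≡ y
    cancel = ℤ-Solver.solve-∀
  cross : + ℤ.∣ + D ℤ.* + k ℤ.+ ℤ.- X ℤ.* + N ∣ ℤ.* + (k * k) ℤ.≤ + C ℤ.* + (N * k)
  cross = subst (λ x → + ℤ.∣ x ∣ ℤ.* + (k * k) ℤ.≤ + C ℤ.* + (N * k)) (sym numerator≡E)
    (subst₂ ℤ._≤_ (ℤₚ.pos-* E (k * k)) (ℤₚ.pos-* C (N * k))
      (+≤+ (subst₂ _≤_ (*-assoc E k k) (*-assoc C N k) (*-monoˡ-≤ k Ek≤CN))))

CloseToBound : ∀ n k .{{_ : NonZero k}} → ℕ → ℕ → Set
CloseToBound n k r C =
  Σ (List (Elem {n} {k})) λ Γ →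
    IsSubgroup Γ × HasOrbits Γ r ×
    (∣ 𝒫 Γ - ((+ k -ℤ + r) / k) ∣ ≤ℚ _/_ (+ C) (k * k) {{m*n≢0 k k}})

SharpUpToO[1/k²] : ℕ → ℕ → Set
SharpUpToO[1/k²] n r = Σ ℕ λ C → Σ ℕ λ K → (k : ℕ) .{{_ : NonZero k}} → K ≤ k → CloseToBound n k r C

∣𝒫-[k-r]/k∣≤C/k² : ∀ {n k} .{{_ : NonZero k}} (Γ : List (Elem {n} {k})) → IsSubgroup Γ →
  ∀ r → HasOrbits Γ r → r ≤ k → ∀ C →
  k * k * #der Γ + k * r * length Γ ≤ k * k * length Γ + C * length Γ →
  ∣ 𝒫 Γ - ((+ k -ℤ + r) / k) ∣ ≤ℚ _/_ (+ C) (k * k) {{m*n≢0 k k}}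
∣𝒫-[k-r]/k∣≤C/k² {k = zero} = ⊥-elim (ℕ.≢-nonZero⁻¹ zero refl)
∣𝒫-[k-r]/k∣≤C/k² {k = suc t} [] (_ , () , _)
∣𝒫-[k-r]/k∣≤C/k² {k = suc t} Γ@(_ ∷ Γ′) Γ-subgroup r orbits r≤k C estimate =
  let E , kD≡wN+E , Ek≤CN = excess-bound (suc t) r w (length Γ) (#der Γ) C r+w≡k
                               (k*|Γ|≤k*#der+r*|Γ| Γ Γ-subgroup r orbits) estimate
  in ∣D/N-[k-r]/k∣≤C/k² t (length Γ′) (#der Γ) r w C E r+w≡k kD≡wN+E Ek≤CN
  where
  w : ℕ
  w = suc t ∸ r
  r+w≡k : r + w ≡ suc t
  r+w≡k = m+[n∸m]≡n r≤k

rotation-sharp : ∀ m′ r′ → SharpUpToO[1/k²] (suc m′ + r′) (suc r′)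
rotation-sharp m′ r′ = C , suc r′ , close
  where
  C : ℕ
  C = (suc m′ + r′) * (suc m′ + r′) + m′ * (r′ * r′)
  close : (k : ℕ) .{{_ : NonZero k}} → suc r′ ≤ k → CloseToBound (suc m′ + r′) k (suc r′) C
  close zero = ⊥-elim (ℕ.≢-nonZero⁻¹ zero refl)
  close (suc t) r≤k = Γ , Γ-subgroup , Γ-orbits , ∣𝒫-[k-r]/k∣≤C/k² Γ Γ-subgroup (suc r′) Γ-orbits r≤k C estimate
    where
    open RotationSubgroup m′ r′ (suc t)
    estimate : suc t * suc t * #der Γ + suc t * suc r′ * length Γ ≤ suc t * suc t * length Γ + C * length Γ
    estimate = subst₂ (λ D N → suc t * suc t * D + suc t * suc r′ * N ≤ suc t * suc t * N + C * N)
      (sym #der-Γ) (sym length-Γ) (rotation-error-bound t m′ r′)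

sharp : ∀ n r → 1 ≤ r → r ≤ n → SharpUpToO[1/k²] n r
sharp n (suc r′) _ r≤n = subst (λ n → SharpUpToO[1/k²] n (suc r′)) n-r+1+r′≡n (rotation-sharp (n ∸ suc r′) r′)
  where
  n-r+1+r′≡n : suc (n ∸ suc r′) + r′ ≡ n
  n-r+1+r′≡n = trans (sym (+-suc (n ∸ suc r′) r′)) (m∸n+n≡m r≤n)

theorem3p6 :
    ((n k : ℕ) .{{_ : NonZero k}} → 1 ≤ n →
      (Γ : List (Elem {n} {k})) → IsSubgroup Γ →
      (r : ℕ) → HasOrbits Γ r →
      ((+ k -ℤ + r) / k) ≤ℚ 𝒫 Γ)
    ×
    ((n r : ℕ) → 1 ≤ r → r ≤ n →
      Σ ℕ λ C → Σ ℕ λ K →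
        (k : ℕ) .{{_ : NonZero k}} → K ≤ k →
        Σ (List (Elem {n} {k})) λ Γ →
          IsSubgroup Γ × HasOrbits Γ r ×
          (∣ 𝒫 Γ - ((+ k -ℤ + r) / k) ∣ ≤ℚ _/_ (+ C) (k * k) {{m*n≢0 k k}}))
theorem3p6 = (λ n k _ → [k-r]/k≤𝒫 n k) , sharp
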